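{- A cover $f:B\to A$ is an isomorphism (in $\mathbf D$) if and only if $\deg f=1$.
   Context: Let $\mathbf C$ be a category and $\mathbf D$ a full subcategory of $\mathbf C$. For arrows $f,g$ of $\mathbf C$ with ${\rm cod}\,f={\rm cod}\,g$, ${\rm Hom}(g,f)$ denotes the collection of all arrows $h$ of $\mathbf C$ with $g=f\circ h$. Standing assumptions: (G1) every diagram $B\to A\leftarrow C$ in $\mathbf D$ has a pullback in $\mathbf C$. (G2) (I) pushouts exist in $\mathbf D$; (II) every arrow of $\mathbf D$ is epic; (III) every monic arrow of $\mathbf D$ is an isomorphism whose inverse is an arrow of $\mathbf D$. (G3) for every object $U$ of $\mathbf C$ there is a set $\Sigma(U)$ of arrows $i$ of $\mathbf C$ with ${\rm dom}\,i$ in $\mathbf D$ and ${\rm cod}\,i=U$ such that for every arrow $u$ of $\mathbf C$ with ${\rm dom}\,u$ in $\mathbf D$ and ${\rm cod}\,u=U$ there is exactly one $i\in\Sigma(U)$ with ${\rm Hom}(u,i)\neq\emptyset$. (G4) there is a function $\deg$ from the collection of arrows of $\mathbf C$ whose codomain lies in $\mathbf D$ to the positive integers such that (I) $\deg(g\circ f)=\deg g\cdot\deg f$ whenever $f,g,g\circ f$ all lie in this collection; (II) $\deg f=\sum_{i\in\Sigma({\rm dom}\,f)}\deg(f\circ i)$ for every such $f$; (III) if $B\xrightarrow{f}A\xleftarrow{g}C$ is a diagram in $\mathbf D$ with pullback $B\xleftarrow{p}U\xrightarrow{q}C$, then $\deg f=\deg q$ and $\deg g=\deg p$. A cover is an arrow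 of $\mathbf D$. -}

module Defs where

open import Level using (Level; _⊔_) renaming (suc to lsuc)
open import Data.Nat using (ℕ; _≤_; _*_)
open import Data.Fin using (Fin)
open import Data.List using (tabulate)
open import Data.Nat.ListAction using (sum)
open import Data.Product using (Σ; Σ-syntax; ∃; ∃-syntax; _×_; _,_; proj₁; proj₂)
open import Function.Bundles using (_↔_; Inverse)
open import Relation.Binary.PropositionalEquality using (_≡_)

record Category (o ℓ : Level) : Set (lsuc (o ⊔ ℓ)) where
  infixr 9 _∘_
  field
    Obj       : Set o
    Hom       : Obj → Obj → Set ℓ
    id        : ∀ {A} → Hom A A
    _∘_       : ∀ {A B C} → Hom B C → Hom A B → Hom A C
    identityˡ : ∀ {A B} {f : Hom A B} → id ∘ f ≡ f
    identityʳ : ∀ {A B} {f : Hom A B} → f ∘ id ≡ f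
    assoc     : ∀ {A B C D} {f : Hom A B} {g : Hom B C} {h : Hom C D} →
                (h ∘ g) ∘ f ≡ h ∘ (g ∘ f)

-- Everything below is relative to a category C and a full subcategory D,
-- given by the predicate inD on objects (D has all C-arrows between D-objects).
module _ {o ℓ d : Level} (C : Category o ℓ) (inD : Category.Obj C → Set d) where
  open Category C

  HomOver : ∀ {X Y Z} → Hom X Z → Hom Y Z → Set ℓ
  HomOver {X} {Y} g f = Σ[ h ∈ Hom X Y ] (g ≡ f ∘ h)

  IsPullback : ∀ {A B C' U} → Hom B A → Hom C' A → Hom U B → Hom U C' → Set (o ⊔ ℓ)
  IsPullback {A} {B} {C'} {U} f g p q =
    (f ∘ p ≡ g ∘ q) ×
    (∀ {X} (x : Hom X B) (y : Hom X C') → f ∘ x ≡ g ∘ y →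
       Σ[ h ∈ Hom X U ] ((p ∘ h ≡ x × q ∘ h ≡ y) ×
         (∀ (h' : Hom X U) → p ∘ h' ≡ x → q ∘ h' ≡ y → h' ≡ h)))

  IsPushoutInD : ∀ {A B C' P} → Hom A B → Hom A C' → Hom B P → Hom C' P → Set (o ⊔ ℓ ⊔ d)
  IsPushoutInD {A} {B} {C'} {P} f g i₁ i₂ =
    inD P × (i₁ ∘ f ≡ i₂ ∘ g) ×
    (∀ {X} → inD X → (x : Hom B X) (y : Hom C' X) → x ∘ f ≡ y ∘ g →
       Σ[ h ∈ Hom P X ] ((h ∘ i₁ ≡ x × h ∘ i₂ ≡ y) ×
         (∀ (h' : Hom P X) → h' ∘ i₁ ≡ x → h' ∘ i₂ ≡ y → h' ≡ h)))

  EpicInD : ∀ {A B} → Hom A B → Set (o ⊔ ℓ ⊔ d)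
  EpicInD {A} {B} f = ∀ {X} → inD X → (g h : Hom B X) → g ∘ f ≡ h ∘ f → g ≡ h

  MonicInD : ∀ {A B} → Hom A B → Set (o ⊔ ℓ ⊔ d)
  MonicInD {A} {B} f = ∀ {X} → inD X → (g h : Hom X A) → f ∘ g ≡ f ∘ h → g ≡ h

  -- f is an isomorphism whose inverse is an arrow of D (automatic for D-objects, D full)
  IsIso : ∀ {A B} → Hom A B → Set ℓ
  IsIso {A} {B} f = Σ[ g ∈ Hom B A ] (g ∘ f ≡ id × f ∘ g ≡ id)

  record StandingAssumptions (s : Level) : Set (o ⊔ ℓ ⊔ d ⊔ lsuc s) where
    field
      G1 : ∀ {A B C'} → inD A → inD B → inD C' → (f : Hom B A) (g : Hom C' A) →
           Σ[ U ∈ Obj ] Σ[ p ∈ Hom U B ] Σ[ q ∈ Hom U C' ] IsPullback f g p q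
      G2-pushout : ∀ {A B C'} → inD A → inD B → inD C' → (f : Hom A B) (g : Hom A C') →
           Σ[ P ∈ Obj ] Σ[ i₁ ∈ Hom B P ] Σ[ i₂ ∈ Hom C' P ] IsPushoutInD f g i₁ i₂
      G2-epic : ∀ {A B} → inD A → inD B → (f : Hom A B) → EpicInD f
      G2-monic-iso : ∀ {A B} → inD A → inD B → (f : Hom A B) → MonicInD f → IsIso f
      -- (G3): Σ(U) is the set of arrows { Σarr U i | i : Σidx U } (injectively indexed)
      Σidx   : Obj → Set s
      Σarr   : (U : Obj) → Σidx U → Σ[ X ∈ Obj ] Hom X U
      Σdom   : ∀ U (i : Σidx U) → inD (proj₁ (Σarr U i))
      Σinj   : ∀ U (i j : Σidx U) → Σarr U i ≡ Σarr U j → i ≡ j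
      Σunique : ∀ {U X} → inD X → (u : Hom X U) →
           Σ[ i ∈ Σidx U ] (HomOver u (proj₂ (Σarr U i)) ×
             (∀ j → HomOver u (proj₂ (Σarr U j)) → j ≡ i))
      -- (G4): deg is given on all arrows, but only its values on arrows with
      -- codomain in D are constrained (i.e. used).
      deg     : ∀ {X Y} → Hom X Y → ℕ
      deg-pos : ∀ {X A} → inD A → (f : Hom X A) → 1 ≤ deg f
      deg-mult : ∀ {X Y Z} → inD Y → inD Z → (f : Hom X Y) (g : Hom Y Z) →
           deg (g ∘ f) ≡ deg g * deg f
      -- (G4)(II): the sum over the set Σ(dom f) (finite, enumerated by some Fin n)
      deg-sum : ∀ {U A} → inD A → (f : Hom U A) →
           Σ[ n ∈ ℕ ] Σ[ e ∈ (Fin n ↔ Σidx U) ]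
             (deg f ≡ sum (tabulate (λ k → deg (f ∘ proj₂ (Σarr U (Inverse.to e k))))))
      deg-pb : ∀ {A B C' U} → inD A → inD B → inD C' →
           (f : Hom B A) (g : Hom C' A) (p : Hom U B) (q : Hom U C') →
           IsPullback f g p q → (deg f ≡ deg q × deg g ≡ deg p)

-- An isomorphism has degree 1 because deg is multiplicative and deg id = 1.
-- Conversely, let U be the kernel pair of f, with projections p and q. By (G4)(III)
-- deg p = deg f = 1, so by (G4)(II) the set Σ(U) has at most one element: every
-- arrow from an object of D into U factors through one and the same arrow i of Σ(U).
-- The diagonal B → U shows that p ∘ i and q ∘ i agree after an arrow of D, hence
-- agree since arrows of D are epic; so p and q agree on every arrow from D into U,
-- which makes f monic in D, hence an isomorphism by (G2)(III).
module Submission where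

open import Level using (Level)
open import Function.Bundles using (_⇔_; mk⇔; _↔_; Inverse)
open import Relation.Binary.PropositionalEquality
open import Relation.Nullary using (Irrelevant; contradiction)
open import Data.Nat using (ℕ; suc; _≤_; _*_; s≤s; >-nonZero)
open import Data.Nat.Properties using (m*n≡1⇒m≡1; *-cancelˡ-≡; *-identityʳ; +-mono-≤; ≤-trans; m≤m+n)
open import Data.Fin using (Fin; zero; suc)
open import Data.List using (tabulate)
open import Data.Nat.ListAction using (sum)
open import Data.Product using (_,_; proj₂)
open import Defs

sum-positive≡1⇒Fin-irrelevant : ∀ n (t : Fin n → ℕ) → (∀ k → 1 ≤ t k) →
                                sum (tabulate t) ≡ 1 → Irrelevant (Fin n)
sum-positive≡1⇒Fin-irrelevant 1 _ _ _ zero zero = refl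
sum-positive≡1⇒Fin-irrelevant (suc (suc n)) t pos sum≡1 =
  contradiction (subst (2 ≤_) sum≡1 two≤sum) λ { (s≤s ()) }
  where
  two≤sum : 2 ≤ sum (tabulate t)
  two≤sum = +-mono-≤ (pos zero) (≤-trans (pos (suc zero)) (m≤m+n _ _))

↔-irrelevant : ∀ {a b} {A : Set a} {B : Set b} → A ↔ B → Irrelevant A → Irrelevant B
↔-irrelevant A↔B irrA x y = begin
  x             ≡⟨ strictlyInverseˡ x ⟨
  to (from x)   ≡⟨ cong to (irrA (from x) (from y)) ⟩
  to (from y)   ≡⟨ strictlyInverseˡ y ⟩
  y             ∎
  where open Inverse A↔B
        open ≡-Reasoning

module _ {o ℓ d s : Level} (C : Category o ℓ) (inD : Category.Obj C → Set d)
         (G : StandingAssumptions C inD s) where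
  open Category C
  open StandingAssumptions G

  deg-id : ∀ {A} → inD A → deg (id {A}) ≡ 1
  deg-id {A} inA = sym (*-cancelˡ-≡ 1 (deg id) (deg id) {{>-nonZero (deg-pos inA id)}} idem)
    where
    idem : deg (id {A}) * 1 ≡ deg id * deg id
    idem = begin
      deg id * 1       ≡⟨ *-identityʳ _ ⟩
      deg id           ≡⟨ cong deg identityˡ ⟨
      deg (id ∘ id)    ≡⟨ deg-mult inA inA id id ⟩
      deg id * deg id  ∎
      where open ≡-Reasoning

  iso⇒deg≡1 : ∀ {A B} → inD A → inD B → (f : Hom B A) → IsIso C inD f → deg f ≡ 1
  iso⇒deg≡1 inA inB f (g , _ , f∘g≡id) = m*n≡1⇒m≡1 (deg f) (deg g) (begin
    deg f * deg g  ≡⟨ deg-mult inB inA g f ⟨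
    deg (f ∘ g)    ≡⟨ cong deg f∘g≡id ⟩
    deg id         ≡⟨ deg-id inA ⟩
    1              ∎)
    where open ≡-Reasoning

  deg≡1⇒Σidx-irrelevant : ∀ {U A} → inD A → (f : Hom U A) → deg f ≡ 1 → Irrelevant (Σidx U)
  deg≡1⇒Σidx-irrelevant inA f deg≡1 with deg-sum inA f
  ... | n , e , deg≡sum = ↔-irrelevant e
    (sum-positive≡1⇒Fin-irrelevant n _ (λ _ → deg-pos inA _) (trans (sym deg≡sum) deg≡1))

  -- Both u and v factor through the unique arrow of Σ(U); the factor of u is epic.
  Σidx-irrelevant⇒equalised : ∀ {U Z} → Irrelevant (Σidx U) → inD Z → (p q : Hom U Z) →
    ∀ {X} → inD X → (u : Hom X U) → p ∘ u ≡ q ∘ u →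
    ∀ {Y} → inD Y → (v : Hom Y U) → p ∘ v ≡ q ∘ v
  Σidx-irrelevant⇒equalised {U} irr inZ p q inX u p∘u≡q∘u inY v
    with Σunique inX u | Σunique inY v
  ... | i , (a , u≡i∘a) , _ | j , (b , v≡i∘b) , _ with irr j i
  ... | refl = begin
    p ∘ v          ≡⟨ cong (p ∘_) v≡i∘b ⟩
    p ∘ (ι ∘ b)    ≡⟨ assoc ⟨
    (p ∘ ι) ∘ b    ≡⟨ cong (_∘ b) p∘ι≡q∘ι ⟩
    (q ∘ ι) ∘ b    ≡⟨ assoc ⟩
    q ∘ (ι ∘ b)    ≡⟨ cong (q ∘_) v≡i∘b ⟨
    q ∘ v          ∎
    where
    open ≡-Reasoning
    ι = proj₂ (Σarr U i)

    p∘ι≡q∘ι : p ∘ ι ≡ q ∘ ι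
    p∘ι≡q∘ι = G2-epic inX (Σdom U i) a inZ (p ∘ ι) (q ∘ ι) (begin
      (p ∘ ι) ∘ a  ≡⟨ assoc ⟩
      p ∘ (ι ∘ a)  ≡⟨ cong (p ∘_) u≡i∘a ⟨
      p ∘ u        ≡⟨ p∘u≡q∘u ⟩
      q ∘ u        ≡⟨ cong (q ∘_) u≡i∘a ⟩
      q ∘ (ι ∘ a)  ≡⟨ assoc ⟨
      (q ∘ ι) ∘ a  ∎)

  deg≡1⇒monic : ∀ {A B} → inD A → inD B → (f : Hom B A) → deg f ≡ 1 → MonicInD C inD f
  deg≡1⇒monic inA inB f deg≡1 inX g h f∘g≡f∘h
    with G1 inA inB inB f f
  ... | U , p , q , isPB@(_ , universal)
    with universal id id refl | universal g h f∘g≡f∘h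
  ... | δ , (p∘δ≡id , q∘δ≡id) , _ | k , (p∘k≡g , q∘k≡h) , _ = begin
    g      ≡⟨ p∘k≡g ⟨
    p ∘ k  ≡⟨ Σidx-irrelevant⇒equalised Σ-irr inB p q inB δ (trans p∘δ≡id (sym q∘δ≡id)) inX k ⟩
    q ∘ k  ≡⟨ q∘k≡h ⟩
    h      ∎
    where
    open ≡-Reasoning
    Σ-irr : Irrelevant (Σidx U)
    Σ-irr = deg≡1⇒Σidx-irrelevant inB p
      (trans (sym (proj₂ (deg-pb inA inB inB f f p q isPB))) deg≡1)

proposition3p5 : ∀ {o ℓ d s : Level} (C : Category o ℓ) (inD : Category.Obj C → Set d)
                   (G : StandingAssumptions C inD s) →
                   ∀ {A B} → inD A → inD B → (f : Category.Hom C B A) →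
                   (IsIso C inD f ⇔ (StandingAssumptions.deg G f ≡ 1))
proposition3p5 C inD G inA inB f = mk⇔
  (iso⇒deg≡1 C inD G inA inB f)
  (λ deg≡1 → G2-monic-iso inB inA f (deg≡1⇒monic C inD G inA inB f deg≡1))
  where open StandingAssumptions G
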